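{- There is a deterministic algorithm which, given $n$ elements, makes $\binom{n}{2}$ comparisons and outputs a $1$-max-set of size at most $\lceil\log_2 n\rceil$.
   Context: Model: each element $x_i$ has an unknown real value $\mathrm{val}(x_i)$. A comparator query on $x_i,x_j$ returns "$x_i\ge x_j$" or "$x_j\ge x_i$"; the answer is correct if $|\mathrm{val}(x_i)-\mathrm{val}(x_j)|>1$ and arbitrary (possibly adversarial) otherwise. Let $x^*$ denote an element of maximum value. A $k$-max-set is a subset of the elements that contains at least one element of value at least $\mathrm{val}(x^*)-k$; the algorithm's output must be such a set for every input and every comparator behavior consistent with the model.
   Formalization: The unknown values $\mathrm{val}(x_i)$ of the elements are taken in ℚ rather than ℝ. -}

module Defs where

open import Data.Nat using (ℕ; _⊔_) renaming (_+_ to _+ℕ_)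
open import Data.Fin using (Fin)
open import Data.List using (List)
open import Data.List.Membership.Propositional using (_∈_)
open import Data.Rational using (ℚ; _+_; _<_; _≤_)
open import Data.Product using (Σ; _×_)
open import Relation.Nullary using (¬_)

-- A deterministic comparison algorithm on n elements (indexed by Fin n),
-- presented as a decision tree.  'query i j l r' asks the comparator about
-- x_i, x_j and continues with l on answer "x_i ≥ x_j", with r on answer
-- "x_j ≥ x_i".  'leaf S' outputs the set S.
data Tree (n : ℕ) : Set where
  leaf  : List (Fin n) → Tree n
  query : Fin n → Fin n → Tree n → Tree n → Tree n

depth : ∀ {n} → Tree n → ℕ
depth (leaf _)        = 0
depth (query _ _ l r) = 1 +ℕ (depth l ⊔ depth r)

-- Reaches val t S : some comparator behaviour consistent with the model
-- (answers are correct whenever the two values differ by more than 1,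
-- arbitrary otherwise) drives the algorithm t to output S.
data Reaches {n : ℕ} (val : Fin n → ℚ) : Tree n → List (Fin n) → Set where
  leaf  : ∀ {S} → Reaches val (leaf S) S
  left  : ∀ {i j l r S} → ¬ (val i + Data.Rational.1ℚ < val j) →
          Reaches val l S → Reaches val (query i j l r) S
  right : ∀ {i j l r S} → ¬ (val j + Data.Rational.1ℚ < val i) →
          Reaches val r S → Reaches val (query i j l r) S

-- S is a k-max-set: it contains an element x with val x ≥ val x* - k,
-- where x* is a maximum, i.e. val y ≤ val x + k for every element y.
IsMaxSet : ∀ {n} → ℚ → (Fin n → ℚ) → List (Fin n) → Set
IsMaxSet {n} k val S = Σ (Fin n) λ x → (x ∈ S) × ((y : Fin n) → val y ≤ val x + k)

{-# OPTIONS --safe #-}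
module Submission where

open import Defs
open import Data.Nat using (ℕ; _≤_)
open import Data.Nat.Combinatorics using (_C_)
open import Data.Nat.Logarithm using (⌈log₂_⌉)
open import Data.Fin using (Fin)
open import Data.List using (List; length)
open import Data.Rational using (ℚ; 1ℚ)
open import Data.Product using (Σ; _×_)

-- Query every pair once and read the answers as a tournament in which x beats y when the
-- comparator said "x ≥ y"; every arc then satisfies val y ≤ val x + 1. As each pair gives at
-- least one arc, the elements of a list L fail to beat, in total, at most |L|(|L|-1)/2
-- elements of L, so some x ∈ L fails to beat fewer than half of them. Greedily keeping such
-- an x and discarding everything it beats leaves fewer than half the candidates, so
-- ⌈log₂ n⌉ rounds yield a set beating every element, in particular a maximal one.

open import Level using (0ℓ)
open import Function using (_∘_)
open import Algebra.Properties.CommutativeSemigroup using (x∙yz≈y∙xz)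
open import Data.Empty using (⊥-elim)
open import Data.Nat using (zero; suc; _+_; _*_; _^_; _<_; z≤n; s≤s; ⌈_/2⌉; ⌊_/2⌋)
open import Data.Nat.Properties
open import Data.Nat.Combinatorics using (nC1≡n; nCk+nC[k+1]≡[n+1]C[k+1])
open import Data.Nat.Induction using (<-wellFounded)
open import Data.Nat.ListAction using (sum)
open import Data.Nat.Logarithm.Core using (⌈log2⌉)
open import Data.Nat.Tactic.RingSolver using (solve-∀)
import Data.Fin as Fin
open import Data.List using ([]; _∷_; map; _++_; filter; allFin)
open import Data.List.Properties using (length-++; length-map; length-tabulate; filter-accept; filter-reject)
import Data.List.Extrema.Nat as ℕExtrema
import Data.List.Membership.DecPropositional as DecMembership
open import Data.List.Membership.Propositional using (_∈_)
open import Data.List.Membership.Propositional.Properties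
  using (∈-filter⁺; ∈-++⁺ˡ; ∈-++⁺ʳ; ∈-map⁺; ∈-allFin)
open import Data.List.Relation.Unary.All as All using (All; []; _∷_)
open import Data.List.Relation.Unary.Any using (here; there)
open import Data.Product using (_,_; ∃-syntax)
open import Data.Product.Properties using (≡-dec)
import Data.Rational as ℚ
import Data.Rational.Properties as ℚ
open import Data.Sum as Sum using (_⊎_; inj₁; inj₂; [_,_]′)
open import Induction.WellFounded using (Acc; acc)
open import Relation.Binary using (Rel; Decidable; Total; DecTotalOrder)
open import Relation.Binary.PropositionalEquality
  using (_≡_; _≢_; refl; sym; trans; cong; cong₂; subst; module ≡-Reasoning)
open import Relation.Nullary using (¬_; Dec; yes; no; ¬?; _⊎-dec_)
open import Relation.Unary using (Pred) renaming (Decidable to Decidable₁)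
open import Data.List.Extrema (DecTotalOrder.totalOrder ℚ.≤-decTotalOrder)
  using (argmax; f[xs]≤f[argmax])

2w<m⇒1+m<2p⇒1+w<p : ∀ {w m p} → 2 * w < m → suc m < 2 * p → suc w < p
2w<m⇒1+m<2p⇒1+w<p {w} {m} {p} 2w<m 1+m<2p = *-cancelˡ-< 2 (suc w) p (begin-strict
  2 * suc w         ≡⟨ *-suc 2 w ⟩
  suc (suc (2 * w)) <⟨ s≤s (s≤s 2w<m) ⟩
  suc (suc m)       ≤⟨ 1+m<2p ⟩
  2 * p             ∎)
  where open ≤-Reasoning

n≤2^⌈log2⌉n : ∀ n (rec : Acc _<_ n) → n ≤ 2 ^ ⌈log2⌉ n rec
n≤2^⌈log2⌉n zero          _        = z≤n
n≤2^⌈log2⌉n (suc zero)    _        = s≤s z≤n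
n≤2^⌈log2⌉n (suc (suc m)) (acc rs) = begin
  2 + m                             ≡⟨ cong (2 +_) (⌊n/2⌋+⌈n/2⌉≡n m) ⟨
  2 + (⌊ m /2⌋ + ⌈ m /2⌉)           ≤⟨ +-monoʳ-≤ 2 (+-monoˡ-≤ ⌈ m /2⌉ (⌊n/2⌋≤⌈n/2⌉ m)) ⟩
  2 + (⌈ m /2⌉ + ⌈ m /2⌉)           ≡⟨ double ⌈ m /2⌉ ⟩
  2 * suc ⌈ m /2⌉                   ≤⟨ *-monoʳ-≤ 2 (n≤2^⌈log2⌉n (suc ⌈ m /2⌉) _) ⟩
  2 ^ ⌈log2⌉ (suc (suc m)) (acc rs) ∎
  where
  open ≤-Reasoning
  double : ∀ c → 2 + (c + c) ≡ 2 * suc c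
  double = solve-∀

1<n⇒1+n<2^[1+⌈log₂n⌉] : ∀ {n} → 1 < n → suc n < 2 ^ suc ⌈log₂ n ⌉
1<n⇒1+n<2^[1+⌈log₂n⌉] {n} 1<n = begin-strict
  suc n       <⟨ +-monoˡ-< n 1<n ⟩
  n + n       ≤⟨ +-mono-≤ n≤2^g n≤2^g ⟩
  2^g + 2^g   ≡⟨ cong (2^g +_) (+-identityʳ 2^g) ⟨
  2 * 2^g     ∎
  where
  open ≤-Reasoning
  2^g = 2 ^ ⌈log₂ n ⌉
  n≤2^g : n ≤ 2^g
  n≤2^g = n≤2^⌈log2⌉n n (<-wellFounded n)

p≤p+1 : ∀ p → p ℚ.≤ p ℚ.+ 1ℚ
p≤p+1 p = subst (ℚ._≤ p ℚ.+ 1ℚ) (ℚ.+-identityʳ p) (ℚ.+-monoʳ-≤ p (ℚ.nonNegative⁻¹ 1ℚ))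

module _ {A : Set} where

  length-filter-disjoint : {P Q : Pred A 0ℓ} (P? : Decidable₁ P) (Q? : Decidable₁ Q) →
                           (∀ {x} → P x → ¬ Q x) →
                           ∀ xs → length (filter P? xs) + length (filter Q? xs) ≤ length xs
  length-filter-disjoint P? Q? disjoint [] = z≤n
  length-filter-disjoint P? Q? disjoint (x ∷ xs)
    with P? x | Q? x | length-filter-disjoint P? Q? disjoint xs
  ... | yes p | yes q | _  = ⊥-elim (disjoint p q)
  ... | yes _ | no _  | ih = s≤s ih
  ... | no _  | yes _ | ih = subst (_≤ suc (length xs)) (sym (+-suc _ _)) (s≤s ih)
  ... | no _  | no _  | ih = m≤n⇒m≤1+n ih

  length*≤sum-map : ∀ {c} (f : A → ℕ) xs → All (λ x → c ≤ f x) xs →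
                    length xs * c ≤ sum (map f xs)
  length*≤sum-map f []       []            = z≤n
  length*≤sum-map f (x ∷ xs) (c≤fx ∷ c≤fxs) = +-mono-≤ c≤fx (length*≤sum-map f xs c≤fxs)

  pairs : List A → List (A × A)
  pairs []       = []
  pairs (x ∷ xs) = map (x ,_) xs ++ pairs xs

  length-pairs : ∀ xs → length (pairs xs) ≡ length xs C 2
  length-pairs []       = refl
  length-pairs (x ∷ xs) = begin
    length (map (x ,_) xs ++ pairs xs)         ≡⟨ length-++ (map (x ,_) xs) ⟩
    length (map (x ,_) xs) + length (pairs xs) ≡⟨ cong₂ _+_ (length-map (x ,_) xs) (length-pairs xs) ⟩
    length xs + length xs C 2                  ≡⟨ cong (_+ length xs C 2) (nC1≡n (length xs)) ⟨
    length xs C 1 + length xs C 2              ≡⟨ nCk+nC[k+1]≡[n+1]C[k+1] (length xs) 1 ⟩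
    suc (length xs) C 2                        ∎
    where open ≡-Reasoning

  pairs-complete : ∀ {x y} xs → x ∈ xs → y ∈ xs → x ≢ y →
                   (x , y) ∈ pairs xs ⊎ (y , x) ∈ pairs xs
  pairs-complete (z ∷ xs) (here refl) (here refl) x≢y = ⊥-elim (x≢y refl)
  pairs-complete (z ∷ xs) (here refl) (there y∈) _    = inj₁ (∈-++⁺ˡ (∈-map⁺ (z ,_) y∈))
  pairs-complete (z ∷ xs) (there x∈)  (here refl) _   = inj₂ (∈-++⁺ˡ (∈-map⁺ (z ,_) x∈))
  pairs-complete (z ∷ xs) (there x∈)  (there y∈) x≢y  =
    Sum.map (∈-++⁺ʳ (map (z ,_) xs)) (∈-++⁺ʳ (map (z ,_) xs)) (pairs-complete xs x∈ y∈ x≢y)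

module Tournament {A : Set} {R : Rel A 0ℓ} (R? : Decidable R) where

  unbeatenBy : A → List A → List A
  unbeatenBy x = filter (λ y → ¬? (R? x y))

  notBeating : A → List A → List A
  notBeating z = filter (λ x → ¬? (R? x z))

  losses : List A → A → ℕ
  losses L x = length (unbeatenBy x L)

  best : A → List A → A
  best z zs = ℕExtrema.argmin (losses (z ∷ zs)) z zs

  dominatingSet : ℕ → List A → List A
  dominatingSet zero    _        = []
  dominatingSet (suc g) []       = []
  dominatingSet (suc g) (z ∷ zs) = b ∷ dominatingSet g (unbeatenBy b (z ∷ zs))
    where b = best z zs

  length-dominatingSet : ∀ g L → length (dominatingSet g L) ≤ g
  length-dominatingSet zero    _        = z≤n
  length-dominatingSet (suc g) []       = z≤n
  length-dominatingSet (suc g) (z ∷ zs) = s≤s (length-dominatingSet g _)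

  losses-cons-beaten : ∀ {x z} L → R x z → losses (z ∷ L) x ≡ losses L x
  losses-cons-beaten L r = cong length (filter-reject (λ y → ¬? (R? _ y)) (λ ¬r → ¬r r))

  losses-cons-unbeaten : ∀ {x z} L → ¬ R x z → losses (z ∷ L) x ≡ suc (losses L x)
  losses-cons-unbeaten L ¬r = cong length (filter-accept (λ y → ¬? (R? _ y)) ¬r)

  notBeating-cons-beating : ∀ {x z} xs → R x z → length (notBeating z (x ∷ xs)) ≡ length (notBeating z xs)
  notBeating-cons-beating xs r = cong length (filter-reject (λ w → ¬? (R? w _)) (λ ¬r → ¬r r))

  notBeating-cons-notBeating : ∀ {x z} xs → ¬ R x z →
                               length (notBeating z (x ∷ xs)) ≡ suc (length (notBeating z xs))
  notBeating-cons-notBeating xs ¬r = cong length (filter-accept (λ w → ¬? (R? w _)) ¬r)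

  sum-losses-cons : ∀ z L xs →
    sum (map (losses (z ∷ L)) xs) ≡ length (notBeating z xs) + sum (map (losses L) xs)
  sum-losses-cons z L []       = refl
  sum-losses-cons z L (x ∷ xs) = cases (R? x z)
    where
    a = losses L x
    c = length (notBeating z xs)
    S = sum (map (losses L) xs)
    rest = sum-losses-cons z L xs
    reorder : a + (c + S) ≡ c + (a + S)
    reorder = x∙yz≈y∙xz +-commutativeSemigroup a c S
    cases : Dec (R x z) →
      losses (z ∷ L) x + sum (map (losses (z ∷ L)) xs) ≡ length (notBeating z (x ∷ xs)) + (a + S)
    cases (yes r) = begin
      losses (z ∷ L) x + sum (map (losses (z ∷ L)) xs) ≡⟨ cong₂ _+_ (losses-cons-beaten L r) rest ⟩
      a + (c + S)                                      ≡⟨ reorder ⟩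
      c + (a + S)                                      ≡⟨ cong (_+ (a + S)) (notBeating-cons-beating xs r) ⟨
      length (notBeating z (x ∷ xs)) + (a + S)         ∎
      where open ≡-Reasoning
    cases (no ¬r) = begin
      losses (z ∷ L) x + sum (map (losses (z ∷ L)) xs) ≡⟨ cong₂ _+_ (losses-cons-unbeaten L ¬r) rest ⟩
      suc a + (c + S)                                  ≡⟨ cong suc reorder ⟩
      suc c + (a + S)                                  ≡⟨ cong (_+ (a + S)) (notBeating-cons-notBeating xs ¬r) ⟨
      length (notBeating z (x ∷ xs)) + (a + S)         ∎
      where open ≡-Reasoning

  module _ (total : Total R) where

    losses+notBeating≤length : ∀ z L → losses L z + length (notBeating z L) ≤ length L
    losses+notBeating≤length z = length-filter-disjoint _ _ (λ ¬zy ¬yz → [ ¬zy , ¬yz ]′ (total z _))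

    sum-losses : ∀ L → 2 * sum (map (losses L) L) + length L ≤ length L * length L
    sum-losses []      = z≤n
    sum-losses (z ∷ L) = begin
      2 * (losses (z ∷ L) z + sum (map (losses (z ∷ L)) L)) + suc m
        ≡⟨ cong (λ s → 2 * s + suc m) (cong₂ _+_ (losses-cons-beaten L (Sum.reduce (total z z)))
                                                  (sum-losses-cons z L L)) ⟩
      2 * (a + (c + S)) + suc m
        ≡⟨ regroup a c S m ⟩
      suc (2 * (a + c) + (2 * S + m))
        ≤⟨ s≤s (+-mono-≤ (*-monoʳ-≤ 2 (losses+notBeating≤length z L)) (sum-losses L)) ⟩
      suc (2 * m + m * m)
        ≡⟨ square m ⟩
      suc m * suc m ∎
      where
      open ≤-Reasoning
      m = length L
      a = losses L z
      c = length (notBeating z L)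
      S = sum (map (losses L) L)
      regroup : ∀ a c S m → 2 * (a + (c + S)) + suc m ≡ suc (2 * (a + c) + (2 * S + m))
      regroup = solve-∀
      square : ∀ m → suc (2 * m + m * m) ≡ suc m * suc m
      square = solve-∀

    best-halves : ∀ z zs → 2 * losses (z ∷ zs) (best z zs) < length (z ∷ zs)
    best-halves z zs = *-cancelˡ-≤ m (begin
      m * suc (2 * w)  ≡⟨ expand m w ⟩
      2 * (m * w) + m  ≤⟨ +-monoˡ-≤ m (*-monoʳ-≤ 2 average) ⟩
      2 * S + m        ≤⟨ sum-losses L ⟩
      m * m            ∎)
      where
      open ≤-Reasoning
      L = z ∷ zs
      m = length L
      w = losses L (best z zs)
      S = sum (map (losses L) L)
      average : m * w ≤ S
      average = length*≤sum-map (losses L) L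
        (ℕExtrema.f[argmin]≤f[⊤] {f = losses L} z zs ∷ ℕExtrema.f[argmin]≤f[xs] z zs)
      expand : ∀ m w → m * suc (2 * w) ≡ 2 * (m * w) + m
      expand = solve-∀

    dominatingSet-dominates : ∀ g L {y} → suc (length L) < 2 ^ suc g → y ∈ L →
                              ∃[ x ] x ∈ dominatingSet g L × R x y
    dominatingSet-dominates zero    (_ ∷ _)      (s≤s (s≤s ())) _
    dominatingSet-dominates (suc g) (z ∷ zs) {y} bound y∈L with R? (best z zs) y
    ... | yes r = best z zs , here refl , r
    ... | no ¬r =
      let x , x∈ , r = dominatingSet-dominates g (unbeatenBy (best z zs) (z ∷ zs))
                         (2w<m⇒1+m<2p⇒1+w<p (best-halves z zs) bound)
                         (∈-filter⁺ (λ y → ¬? (R? (best z zs) y)) y∈L ¬r)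
      in x , there x∈ , r

dominating⇒IsMaxSet : ∀ {n k} (val : Fin (suc n) → ℚ) S →
                      (∀ y → ∃[ x ] x ∈ S × val y ℚ.≤ val x ℚ.+ k) → IsMaxSet k val S
dominating⇒IsMaxSet val S dominating =
  let x , x∈S , top≤x+k = dominating top in x , x∈S , λ y → ℚ.≤-trans (≤top y) top≤x+k
  where
  top = argmax val Fin.zero (allFin _)
  ≤top : ∀ y → val y ℚ.≤ val top
  ≤top y = All.lookup (f[xs]≤f[argmax] {f = val} Fin.zero (allFin _)) (∈-allFin y)

module _ {n : ℕ} where

  -- (i , j) ∈ ws records the answer "x_i ≥ x_j".
  queryAll : List (Fin n × Fin n) → (List (Fin n × Fin n) → List (Fin n)) → Tree n
  queryAll []             out = leaf (out [])
  queryAll ((i , j) ∷ ps) out =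
    query i j (queryAll ps (out ∘ ((i , j) ∷_))) (queryAll ps (out ∘ ((j , i) ∷_)))

  depth-queryAll : ∀ ps out → depth (queryAll ps out) ≤ length ps
  depth-queryAll []       out = z≤n
  depth-queryAll (_ ∷ ps) out = s≤s (⊔-lub (depth-queryAll ps _) (depth-queryAll ps _))

  Allowed : (Fin n → ℚ) → Fin n × Fin n → Set
  Allowed val (i , j) = ¬ (val i ℚ.+ 1ℚ ℚ.< val j)

  Covers : List (Fin n × Fin n) → List (Fin n × Fin n) → Set
  Covers ws ps = ∀ {i j} → (i , j) ∈ ps → (i , j) ∈ ws ⊎ (j , i) ∈ ws

  reaches-queryAll : ∀ {val ps out S} → Reaches val (queryAll ps out) S →
                     ∃[ ws ] All (Allowed val) ws × Covers ws ps × S ≡ out ws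
  reaches-queryAll {ps = []} leaf = [] , [] , (λ ()) , refl
  reaches-queryAll {ps = (i , j) ∷ _} (left ok run) =
    let ws , allowed , covers , S≡out = reaches-queryAll run
    in (i , j) ∷ ws , ok ∷ allowed ,
       (λ { (here refl) → inj₁ (here refl) ; (there p) → Sum.map there there (covers p) }) , S≡out
  reaches-queryAll {ps = (i , j) ∷ _} (right ok run) =
    let ws , allowed , covers , S≡out = reaches-queryAll run
    in (j , i) ∷ ws , ok ∷ allowed ,
       (λ { (here refl) → inj₂ (here refl) ; (there p) → Sum.map there there (covers p) }) , S≡out

  Beats : List (Fin n × Fin n) → Rel (Fin n) 0ℓ
  Beats ws x y = x ≡ y ⊎ (x , y) ∈ ws

  beats? : ∀ ws → Decidable (Beats ws)
  beats? ws x y = (x Fin.≟ y) ⊎-dec ((x , y) ∈? ws)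
    where open DecMembership (≡-dec Fin._≟_ Fin._≟_)

  Beats-total : ∀ {ws} → Covers ws (pairs (allFin n)) → Total (Beats ws)
  Beats-total covers x y with x Fin.≟ y
  ... | yes x≡y = inj₁ (inj₁ x≡y)
  ... | no  x≢y = Sum.map inj₂ inj₂
    ([ covers , Sum.swap ∘ covers ]′ (pairs-complete (allFin n) (∈-allFin x) (∈-allFin y) x≢y))

  Beats-sound : ∀ {val ws x y} → All (Allowed val) ws → Beats ws x y → val y ℚ.≤ val x ℚ.+ 1ℚ
  Beats-sound _       (inj₁ refl)  = p≤p+1 _
  Beats-sound allowed (inj₂ xy∈ws) = ℚ.≮⇒≥ (All.lookup allowed xy∈ws)

lemma4 : (n : ℕ) → 2 ≤ n →
    Σ (Tree n) λ t →
      (depth t ≤ n C 2) ×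
      ((val : Fin n → ℚ) (S : List (Fin n)) → Reaches val t S →
         (length S ≤ ⌈log₂ n ⌉) × IsMaxSet 1ℚ val S)
lemma4 n@(suc _) 1<n = queryAll (pairs (allFin n)) out , depth≤nC2 , correct
  where
  out : List (Fin n × Fin n) → List (Fin n)
  out ws = Tournament.dominatingSet (beats? ws) ⌈log₂ n ⌉ (allFin n)

  length-allFin : length (allFin n) ≡ n
  length-allFin = length-tabulate (λ i → i)

  depth≤nC2 : depth (queryAll (pairs (allFin n)) out) ≤ n C 2
  depth≤nC2 = ≤-trans (depth-queryAll (pairs (allFin n)) out)
    (≤-reflexive (trans (length-pairs (allFin n)) (cong (_C 2) length-allFin)))

  correct : (val : Fin n → ℚ) (S : List (Fin n)) → Reaches val (queryAll (pairs (allFin n)) out) S →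
            (length S ≤ ⌈log₂ n ⌉) × IsMaxSet 1ℚ val S
  correct val S run with reaches-queryAll run
  ... | ws , allowed , covers , refl =
    length-dominatingSet ⌈log₂ n ⌉ (allFin n) , dominating⇒IsMaxSet val (out ws) dominating
    where
    open Tournament (beats? ws)
    bound : suc (length (allFin n)) < 2 ^ suc ⌈log₂ n ⌉
    bound = subst (λ m → suc m < 2 ^ suc ⌈log₂ n ⌉) (sym length-allFin)
                  (1<n⇒1+n<2^[1+⌈log₂n⌉] 1<n)
    dominating : ∀ y → ∃[ x ] x ∈ out ws × val y ℚ.≤ val x ℚ.+ 1ℚ
    dominating y =
      let x , x∈ , x-beats-y = dominatingSet-dominates (Beats-total covers) ⌈log₂ n ⌉ (allFin n)
                                 bound (∈-allFin y)
      in x , x∈ , Beats-sound allowed x-beats-y
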